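{- Let $k\in\mathbb{N}$ and $S=\langle 6k+7,6k+11,6k+13\rangle$. Then (1) $\mathrm{PF}(S)=\{12k^2+32k+15,\ 12k^2+38k+30\}$; (2) $\mathrm{F}(S)=12k^2+38k+30$; (3) $\mathrm{g}(S)=6k^2+20k+16$.
   Context: $\mathbb{N}=\{0,1,2,\dots\}$. For $X\subseteq\mathbb{N}$, $\langle X\rangle$ is the submonoid of $(\mathbb{N},+)$ generated by $X$; here it is a numerical semigroup. $\mathrm{F}(S)$ is the largest integer not in $S$, $\mathrm{g}(S)=|\mathbb{N}\setminus S|$, and $\mathrm{PF}(S)$ is the set of integers $x\notin S$ with $x+s\in S$ for all $s\in S\setminus\{0\}$. -}

module Defs where

open import Data.Nat using (ℕ; zero; suc; _+_; _*_)
open import Data.Integer as ℤ using (ℤ; +_)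
open import Data.List using (List; length)
open import Data.List.Membership.Propositional using (_∈_)
open import Data.List.Relation.Unary.Unique.Propositional using (Unique)
open import Data.Product using (Σ; _×_; ∃)
open import Relation.Binary.PropositionalEquality using (_≡_; _≢_)
open import Relation.Nullary using (¬_)
open import Function.Bundles using (_⇔_)

data ⟨_⟩ (X : List ℕ) : ℕ → Set where
  zero∈ : ⟨ X ⟩ 0
  add∈  : ∀ {g n} → g ∈ X → ⟨ X ⟩ n → ⟨ X ⟩ (g + n)

_∈ℤ_ : ℤ → (ℕ → Set) → Set
z ∈ℤ S = Σ ℕ (λ n → z ≡ + n × S n)

IsPF : (ℕ → Set) → ℤ → Set
IsPF S x = ¬ (x ∈ℤ S) × (∀ s → S s → s ≢ 0 → (x ℤ.+ + s) ∈ℤ S)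

IsFrobenius : (ℕ → Set) → ℤ → Set
IsFrobenius S f = ¬ (f ∈ℤ S) × (∀ z → ¬ (z ∈ℤ S) → z ℤ.≤ f)

HasGenus : (ℕ → Set) → ℕ → Set
HasGenus S n = Σ (List ℕ) (λ l → Unique l × (∀ x → (x ∈ l) ⇔ (¬ S x)) × length l ≡ n)

{-# OPTIONS --safe #-}
-- Put A = 6k+7, so that B = A + 4 and C = A + 6, and write every n in the mixed radix
-- n = 6v + e + iA with 6v + e < A (the residue of n mod A). Then n ∈ S iff i is at least
-- the height of the column (e, v), i.e. iff n lies above the Apéry element of its class;
-- each Apéry element is an explicit combination of B and C, and closure under adding A, B
-- and C is a carry computation in the mixed radix. So the gaps are the points below the
-- Apéry elements: the genus is the sum of the heights, the largest gap F is the top of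
-- column (2, 0), and a pseudo-Frobenius gap must be the top of its column (else adding A
-- gives a gap) and must not be moved onto a gap by B or C, which leaves only P and F.
module Submission where

open import Defs
open import Data.Nat
  using (ℕ; zero; suc; _+_; _*_; _≤_; _<_; _≥_; _≤?_; _<?_; z≤n; s≤s; z<s; NonZero; ≢-nonZero)
open import Data.Nat.Properties
open import Data.Nat.DivMod using (_%_; _/_; m≡m%n+[m/n]*n; m%n<n; [m+kn]%n≡m%n; m<n⇒m%n≡m)
open import Data.Nat.ListAction using (sum)
open import Data.Nat.Tactic.RingSolver using (solve-∀)
open import Data.Integer as ℤ using (ℤ; +_; -[1+_]; +≤+; -≤+)
import Data.Integer.Properties as ℤ
open import Data.List using (List; []; _∷_; _++_; map; length; downFrom)
open import Data.List.Properties using (length-++; length-map; length-downFrom; map-cong)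
open import Data.List.Membership.Propositional using (_∈_)
open import Data.List.Membership.Propositional.Properties
  using (∈-map⁺; ∈-map⁻; ∈-++⁺ˡ; ∈-++⁺ʳ; ∈-++⁻; ∈-downFrom⁺; ∈-downFrom⁻)
open import Data.List.Relation.Unary.Any using (here; there)
open import Data.List.Relation.Unary.All as All using (All; []; _∷_)
open import Data.List.Relation.Unary.Unique.Propositional using (Unique; []; _∷_)
open import Data.List.Relation.Unary.Unique.Propositional.Properties using (downFrom⁺)
import Data.List.Relation.Unary.Unique.Propositional.Properties as Unique
open import Data.Product using (Σ-syntax; _×_; _,_; proj₁; proj₂)
open import Data.Sum as Sum using (_⊎_; inj₁; inj₂; [_,_]′)
open import Data.Empty using (⊥)
open import Function.Base using (id; _∘_)
open import Function.Bundles using (_⇔_; mk⇔; Equivalence)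
open import Algebra.Properties.CommutativeSemigroup +-commutativeSemigroup using (x∙yz≈y∙xz)
open import Relation.Nullary using (¬_; yes; no; contradiction)
open import Relation.Nullary.Decidable using (True; toWitness)
open import Relation.Binary.PropositionalEquality

private variable
  m n d g : ℕ

module _ {X : List ℕ} where

  ⟨⟩-+ : ⟨ X ⟩ m → ⟨ X ⟩ n → ⟨ X ⟩ (m + n)
  ⟨⟩-+ zero∈ n∈ = n∈
  ⟨⟩-+ {n = n} (add∈ {g} {m} g∈X m∈) n∈ = subst ⟨ X ⟩ (sym (+-assoc g m n)) (add∈ g∈X (⟨⟩-+ m∈ n∈))

  ⟨⟩-generator : g ∈ X → ⟨ X ⟩ g
  ⟨⟩-generator {g} g∈X = subst ⟨ X ⟩ (+-identityʳ g) (add∈ g∈X zero∈)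

  ⟨⟩-multiple : g ∈ X → ∀ m → ⟨ X ⟩ (m * g)
  ⟨⟩-multiple g∈X zero = zero∈
  ⟨⟩-multiple g∈X (suc m) = add∈ g∈X (⟨⟩-multiple g∈X m)

  isPF⁺ : ¬ ⟨ X ⟩ n → (∀ {g} → g ∈ X → ⟨ X ⟩ (n + g)) → IsPF ⟨ X ⟩ (+ n)
  isPF⁺ {n} n∉ n+X⊆ = (λ (_ , eq , n∈) → n∉ (subst ⟨ X ⟩ (sym (ℤ.+-injective eq)) n∈)) , shift
    where
    shift : ∀ s → ⟨ X ⟩ s → s ≢ 0 → (+ n ℤ.+ + s) ∈ℤ ⟨ X ⟩
    shift _ zero∈ s≢0 = contradiction refl s≢0
    shift _ (add∈ {g} {m} g∈X m∈) _ =
      n + (g + m) , refl , subst ⟨ X ⟩ (+-assoc n g m) (⟨⟩-+ (n+X⊆ g∈X) m∈)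

module _ {S : ℕ → Set} where

  isPF⁻ : ∀ {s} → IsPF S (+ n) → S s → s ≢ 0 → S (n + s)
  isPF⁻ (_ , shift) s∈ s≢0 with shift _ s∈ s≢0
  ... | _ , eq , m∈ = subst S (sym (ℤ.+-injective eq)) m∈

  module _ {f : ℕ} (f∉S : ¬ S f) (>f⇒∈S : ∀ {n} → f < n → S n) where

    isFrobenius : IsFrobenius S (+ f)
    isFrobenius = (λ (_ , eq , f∈) → f∉S (subst S (sym (ℤ.+-injective eq)) f∈)) , bound
      where
      bound : ∀ z → ¬ (z ∈ℤ S) → z ℤ.≤ + f
      bound -[1+ _ ] _ = -≤+
      bound (+ n) n∉ with n ≤? f
      ... | yes n≤f = +≤+ n≤f
      ... | no n≰f = contradiction (n , refl , >f⇒∈S (≰⇒> n≰f)) n∉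

    isPF⇒nonNegative : ∀ {m} → ¬ IsPF S -[1+ m ]
    isPF⇒nonNegative {m} (_ , shift) with shift (f + suc m) (>f⇒∈S (m<m+n f z<s)) (m+1+n≢0 f)
    ... | _ , eq , n∈ = f∉S (subst S (ℤ.+-injective (trans (sym eq) sum≡f)) n∈)
      where
      sum≡f : -[1+ m ] ℤ.+ + (f + suc m) ≡ + f
      sum≡f = trans (ℤ.⊖-≥ (m≤n+m (suc m) f)) (cong +_ (m+n∸n≡m f (suc m)))

divMod-unique : ∀ {r r' i i'} .{{_ : NonZero d}} → r < d → r' < d →
                r + i * d ≡ r' + i' * d → r ≡ r' × i ≡ i'
divMod-unique {d} {r} {r'} {i} {i'} r<d r'<d eq =
  r≡r' , *-cancelʳ-≡ i i' d (+-cancelˡ-≡ r _ _ (trans eq (cong (_+ i' * d) (sym r≡r'))))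
  where
  r≡r' : r ≡ r'
  r≡r' = begin
    r                  ≡⟨ m<n⇒m%n≡m r<d ⟨
    r % d              ≡⟨ [m+kn]%n≡m%n r i d ⟨
    (r + i * d) % d    ≡⟨ cong (_% d) eq ⟩
    (r' + i' * d) % d  ≡⟨ [m+kn]%n≡m%n r' i' d ⟩
    r' % d             ≡⟨ m<n⇒m%n≡m r'<d ⟩
    r'                 ∎
    where open ≡-Reasoning

module _ {A B : Set} where

  dependentProduct : List A → (A → List B) → List (A × B)
  dependentProduct []       ys = []
  dependentProduct (x ∷ xs) ys = map (x ,_) (ys x) ++ dependentProduct xs ys

  ∈-dependentProduct⁺ : ∀ {xs} ys {x y} → x ∈ xs → y ∈ ys x → (x , y) ∈ dependentProduct xs ys
  ∈-dependentProduct⁺ {x ∷ _} ys (here refl) y∈ = ∈-++⁺ˡ (∈-map⁺ (x ,_) y∈)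
  ∈-dependentProduct⁺ {x ∷ _} ys (there x∈) y∈ =
    ∈-++⁺ʳ (map (x ,_) (ys x)) (∈-dependentProduct⁺ ys x∈ y∈)

  ∈-dependentProduct⁻ : ∀ xs ys {x y} → (x , y) ∈ dependentProduct xs ys → x ∈ xs × y ∈ ys x
  ∈-dependentProduct⁻ (x′ ∷ xs) ys p with ∈-++⁻ (map (x′ ,_) (ys x′)) p
  ... | inj₂ p′ = let x∈ , y∈ = ∈-dependentProduct⁻ xs ys p′ in there x∈ , y∈
  ... | inj₁ p′ with ∈-map⁻ (x′ ,_) p′
  ...   | _ , y∈ , refl = here refl , y∈

  dependentProduct⁺ : ∀ {xs ys} → Unique xs → (∀ x → Unique (ys x)) → Unique (dependentProduct xs ys)
  dependentProduct⁺ {[]}     _            _     = []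
  dependentProduct⁺ {x ∷ xs} {ys} (x∉xs ∷ xs!) ys! =
    Unique.++⁺ (Unique.map⁺ (cong proj₂) (ys! x)) (dependentProduct⁺ xs! ys!) disjoint
    where
    disjoint : ∀ {p} → ¬ (p ∈ map (x ,_) (ys x) × p ∈ dependentProduct xs ys)
    disjoint (p∈ , p∈′) with ∈-map⁻ (x ,_) p∈
    ... | _ , _ , refl = All.lookup x∉xs (proj₁ (∈-dependentProduct⁻ xs ys p∈′)) refl

  length-dependentProduct : ∀ xs ys →
                            length (dependentProduct xs ys) ≡ sum (map (λ x → length (ys x)) xs)
  length-dependentProduct []       ys = refl
  length-dependentProduct (x ∷ xs) ys = begin
    length (map (x ,_) (ys x) ++ dependentProduct xs ys)
      ≡⟨ length-++ (map (x ,_) (ys x)) ⟩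
    length (map (x ,_) (ys x)) + length (dependentProduct xs ys)
      ≡⟨ cong₂ _+_ (length-map (x ,_) (ys x)) (length-dependentProduct xs ys) ⟩
    length (ys x) + sum (map (λ x → length (ys x)) xs)
      ∎
    where open ≡-Reasoning

map-injectiveOn⁺ : ∀ {A B : Set} {P : A → Set} (f : A → B) →
                   (∀ {x y} → P x → P y → f x ≡ f y → x ≡ y) →
                   ∀ {xs} → All P xs → Unique xs → Unique (map f xs)
map-injectiveOn⁺ {P = P} f inj {[]}     _          _            = []
map-injectiveOn⁺ {P = P} f inj {x ∷ xs} (px ∷ pxs) (x∉xs ∷ xs!) =
  apart pxs x∉xs ∷ map-injectiveOn⁺ f inj pxs xs!
  where
  apart : ∀ {ys} → All P ys → All (x ≢_) ys → All (f x ≢_) (map f ys)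
  apart []         []           = []
  apart (py ∷ pys) (x≢y ∷ x≢ys) = (λ eq → x≢y (inj px py eq)) ∷ apart pys x≢ys

sum-downFrom-affine : ∀ {f : ℕ → ℕ} c n → (∀ v → f v ≡ c + v) →
                      2 * sum (map f (downFrom n)) + n ≡ n * (2 * c + n)
sum-downFrom-affine c zero    _ = refl
sum-downFrom-affine {f} c (suc n) f≗ = begin
  2 * (f n + s) + suc n            ≡⟨ cong (λ x → 2 * (x + s) + suc n) (f≗ n) ⟩
  2 * (c + n + s) + suc n          ≡⟨ rearrange c n s ⟩
  (2 * s + n) + (2 * c + 2 * n + 1) ≡⟨ cong (_+ (2 * c + 2 * n + 1)) (sum-downFrom-affine c n f≗) ⟩
  n * (2 * c + n) + (2 * c + 2 * n + 1) ≡⟨ square c n ⟩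
  suc n * (2 * c + suc n)          ∎
  where
  open ≡-Reasoning
  s : ℕ
  s = sum (map f (downFrom n))
  rearrange : ∀ c n s → 2 * (c + n + s) + suc n ≡ (2 * s + n) + (2 * c + 2 * n + 1)
  rearrange = solve-∀
  square : ∀ c n → n * (2 * c + n) + (2 * c + 2 * n + 1) ≡ suc n * (2 * c + suc n)
  square = solve-∀

sum-downFrom-suc : ∀ (f : ℕ → ℕ) n →
                   sum (map f (downFrom (suc n))) ≡ f 0 + sum (map (f ∘ suc) (downFrom n))
sum-downFrom-suc f zero    = refl
sum-downFrom-suc f (suc n) = begin
  f (suc n) + sum (map f (downFrom (suc n)))            ≡⟨ cong (λ x → f (suc n) + x) (sum-downFrom-suc f n) ⟩
  f (suc n) + (f 0 + sum (map (f ∘ suc) (downFrom n)))  ≡⟨ x∙yz≈y∙xz (f (suc n)) (f 0) _ ⟩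
  f 0 + (f (suc n) + sum (map (f ∘ suc) (downFrom n)))  ∎
  where open ≡-Reasoning

genus-arithmetic : ∀ k c₀ c₁ c₂ c₄ →
  2 * c₀ + (2 + k) ≡ (2 + k) * (2 * 0 + (2 + k)) →
  2 * c₁ + (1 + k) ≡ (1 + k) * (2 * (3 + k) + (1 + k)) →
  2 * c₂ + k ≡ k * (2 * 2 + k) →
  2 * c₄ + (1 + k) ≡ (1 + k) * (2 * 1 + (1 + k)) →
  c₁ + (c₄ + (c₁ + ((5 + (k + k) + c₂) + (c₁ + (c₀ + 0))))) ≡ 6 * k * k + 20 * k + 16
genus-arithmetic k c₀ c₁ c₂ c₄ h₀ h₁ h₂ h₄ =
  *-cancelˡ-≡ _ _ 2 (+-cancelʳ-≡ (6 + 6 * k) _ _ (begin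
    2 * (c₁ + (c₄ + (c₁ + ((5 + (k + k) + c₂) + (c₁ + (c₀ + 0)))))) + (6 + 6 * k)
      ≡⟨ collect k c₀ c₁ c₂ c₄ ⟩
    (2 * c₀ + (2 + k)) + 3 * (2 * c₁ + (1 + k)) + (2 * c₂ + k) + (2 * c₄ + (1 + k)) + 2 * (5 + (k + k))
      ≡⟨ cong (_+ 2 * (5 + (k + k))) (cong₂ _+_ (cong₂ _+_ (cong₂ _+_ h₀ (cong (3 *_) h₁)) h₂) h₄) ⟩
    (2 + k) * (2 * 0 + (2 + k)) + 3 * ((1 + k) * (2 * (3 + k) + (1 + k))) + k * (2 * 2 + k)
      + (1 + k) * (2 * 1 + (1 + k)) + 2 * (5 + (k + k))
      ≡⟨ expand k ⟩
    2 * (6 * k * k + 20 * k + 16) + (6 + 6 * k) ∎))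
  where
  open ≡-Reasoning
  collect : ∀ k c₀ c₁ c₂ c₄ →
    2 * (c₁ + (c₄ + (c₁ + ((5 + (k + k) + c₂) + (c₁ + (c₀ + 0)))))) + (6 + 6 * k)
    ≡ (2 * c₀ + (2 + k)) + 3 * (2 * c₁ + (1 + k)) + (2 * c₂ + k) + (2 * c₄ + (1 + k)) + 2 * (5 + (k + k))
  collect = solve-∀
  expand : ∀ k →
    (2 + k) * (2 * 0 + (2 + k)) + 3 * ((1 + k) * (2 * (3 + k) + (1 + k))) + k * (2 * 2 + k)
      + (1 + k) * (2 * 1 + (1 + k)) + 2 * (5 + (k + k))
    ≡ 2 * (6 * k * k + 20 * k + 16) + (6 + 6 * k)
  expand = solve-∀

module Semigroup (k : ℕ) where

  A B C : ℕ
  A = 6 * k + 7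
  B = 6 * k + 11
  C = 6 * k + 13

  X : List ℕ
  X = A ∷ B ∷ C ∷ []

  S : ℕ → Set
  S = ⟨ X ⟩

  A∈X : A ∈ X
  A∈X = here refl

  B∈X : B ∈ X
  B∈X = there (here refl)

  C∈X : C ∈ X
  C∈X = there (there (here refl))

  A≢0 : A ≢ 0
  A≢0 = m+1+n≢0 (6 * k)

  B≢0 : B ≢ 0
  B≢0 = m+1+n≢0 (6 * k)

  C≢0 : C ≢ 0
  C≢0 = m+1+n≢0 (6 * k)

  instance
    A-nonZero : NonZero A
    A-nonZero = ≢-nonZero A≢0

  pos : ℕ → ℕ → ℕ → ℕ
  pos e v i = 6 * v + e + i * A

  -- The number of v with 6 v + e < A.
  width : ℕ → ℕ
  width zero    = 2 + k
  width (suc _) = 1 + k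

  -- pos e v (height e v) is the Apéry element of S with respect to A in the class of 6 v + e.
  height : ℕ → ℕ → ℕ
  height 0 v       = v
  height 1 v       = 3 + (v + k)
  height 2 zero    = 5 + (k + k)
  height 2 (suc v) = 2 + v
  height 3 v       = 3 + (v + k)
  height 4 v       = 1 + v
  height 5 v       = 3 + (v + k)
  height _ _       = 0

  residue≤ : ∀ {e v} → e < 6 → v < width e → 6 * v + e ≤ 6 * k + 6
  residue≤ {zero}  {v} _ (s≤s v≤1+k) = begin
    6 * v + 0       ≡⟨ +-identityʳ (6 * v) ⟩
    6 * v           ≤⟨ *-monoʳ-≤ 6 v≤1+k ⟩
    6 * suc k       ≡⟨ *-suc 6 k ⟩
    6 + 6 * k       ≡⟨ +-comm 6 (6 * k) ⟩
    6 * k + 6       ∎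
    where open ≤-Reasoning
  residue≤ {suc e} e<6 (s≤s v≤k) = +-mono-≤ (*-monoʳ-≤ 6 v≤k) (<⇒≤ e<6)

  residue<A : ∀ {e v} → e < 6 → v < width e → 6 * v + e < A
  residue<A {e} {v} e<6 v<w = subst (6 * v + e <_) (sym (+-suc (6 * k) 6)) (s≤s (residue≤ e<6 v<w))

  A≤residue : ∀ {e v} → e < 6 → width e ≤ v → A ≤ 6 * v + e
  A≤residue {zero} {v} _ w≤v = begin
    6 * k + 7        ≤⟨ +-monoʳ-≤ (6 * k) (m≤m+n 7 5) ⟩
    6 * k + 12       ≡⟨ twelve k ⟩
    6 * (2 + k) + 0  ≤⟨ +-monoˡ-≤ 0 (*-monoʳ-≤ 6 w≤v) ⟩
    6 * v + 0        ∎
    where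
    open ≤-Reasoning
    twelve : ∀ k → 6 * k + 12 ≡ 6 * (2 + k) + 0
    twelve = solve-∀
  A≤residue {suc e} {v} _ w≤v = begin
    6 * k + 7        ≡⟨ seven k ⟩
    6 * (1 + k) + 1  ≤⟨ +-mono-≤ (*-monoʳ-≤ 6 w≤v) (s≤s z≤n) ⟩
    6 * v + suc e    ∎
    where
    open ≤-Reasoning
    seven : ∀ k → 6 * k + 7 ≡ 6 * (1 + k) + 1
    seven = solve-∀

  residue<A⇒<width : ∀ {e v} → e < 6 → 6 * v + e < A → v < width e
  residue<A⇒<width {e} {v} e<6 r<A with v <? width e
  ... | yes v<w = v<w
  ... | no v≮w = contradiction (A≤residue e<6 (≮⇒≥ v≮w)) (<⇒≱ r<A)

  private
    6v+e≡e+v*6 : ∀ e v → 6 * v + e ≡ e + v * 6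
    6v+e≡e+v*6 e v = trans (+-comm (6 * v) e) (cong (λ x → e + x) (*-comm 6 v))

  pos-injective : ∀ {e v i e′ v′ i′} → e < 6 → v < width e → e′ < 6 → v′ < width e′ →
                  pos e v i ≡ pos e′ v′ i′ → e ≡ e′ × v ≡ v′ × i ≡ i′
  pos-injective {e} {v} {_} {e′} {v′} e<6 v<w e′<6 v′<w′ eq
    with divMod-unique (residue<A e<6 v<w) (residue<A e′<6 v′<w′) eq
  ... | r≡r′ , i≡i′
    with divMod-unique e<6 e′<6 (trans (sym (6v+e≡e+v*6 e v)) (trans r≡r′ (6v+e≡e+v*6 e′ v′)))
  ... | e≡e′ , v≡v′ = e≡e′ , v≡v′ , i≡i′

  pos-surjective : ∀ n → Σ[ e ∈ ℕ ] Σ[ v ∈ ℕ ] Σ[ i ∈ ℕ ] e < 6 × v < width e × n ≡ pos e v i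
  pos-surjective n = e , v , n / A , e<6 , residue<A⇒<width e<6 r<A , n≡
    where
    r e v : ℕ
    r = n % A
    e = r % 6
    v = r / 6
    e<6 : e < 6
    e<6 = m%n<n r 6
    r≡ : r ≡ 6 * v + e
    r≡ = trans (m≡m%n+[m/n]*n r 6) (sym (6v+e≡e+v*6 e v))
    r<A : 6 * v + e < A
    r<A = subst (_< A) r≡ (m%n<n n A)
    n≡ : n ≡ pos e v (n / A)
    n≡ = trans (m≡m%n+[m/n]*n n A) (cong (_+ n / A * A) r≡)

  data Placed (R : ℕ → ℕ → Set) (n : ℕ) : Set where
    placed : ∀ e v i → e < 6 → v < width e → R i (height e v) → n ≡ pos e v i → Placed R n

  Gap Element : ℕ → Set
  Gap     = Placed _<_
  Element = Placed _≥_

  gap-or-element : ∀ n → Gap n ⊎ Element n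
  gap-or-element n with pos-surjective n
  ... | e , v , i , e<6 , v<w , n≡ with i <? height e v
  ...   | yes i<h = inj₁ (placed e v i e<6 v<w i<h n≡)
  ...   | no i≮h  = inj₂ (placed e v i e<6 v<w (≮⇒≥ i≮h) n≡)

  gap∩element : Gap n → Element n → ⊥
  gap∩element (placed e v i e<6 v<w i<h refl) (placed e′ v′ i′ e′<6 v′<w′ h≤i′ eq)
    with pos-injective {i = i} {i′ = i′} e<6 v<w e′<6 v′<w′ eq
  ... | refl , refl , refl = <⇒≱ i<h h≤i′

  A+pos : ∀ e v i → A + pos e v i ≡ pos e v (suc i)
  A+pos e v i = identity k e v i
    where
    identity : ∀ k e v i → 6 * k + 7 + (6 * v + e + i * (6 * k + 7))
             ≡ 6 * v + e + (1 + i) * (6 * k + 7)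
    identity = solve-∀

  B+pos : ∀ e v i → B + pos e v i ≡ pos (4 + e) v (suc i)
  B+pos e v i = identity k e v i
    where
    identity : ∀ k e v i → 6 * k + 11 + (6 * v + e + i * (6 * k + 7))
             ≡ 6 * v + (4 + e) + (1 + i) * (6 * k + 7)
    identity = solve-∀

  B+pos-carry : ∀ e v i → B + pos (2 + e) v i ≡ pos e (suc v) (suc i)
  B+pos-carry e v i = identity k e v i
    where
    identity : ∀ k e v i → 6 * k + 11 + (6 * v + (2 + e) + i * (6 * k + 7))
             ≡ 6 * (1 + v) + e + (1 + i) * (6 * k + 7)
    identity = solve-∀

  B+pos-wrap : ∀ e i → B + pos (3 + e) k i ≡ pos e 0 (2 + i)
  B+pos-wrap e i = identity k e i
    where
    identity : ∀ k e i → 6 * k + 11 + (6 * k + (3 + e) + i * (6 * k + 7))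
             ≡ 6 * 0 + e + (2 + i) * (6 * k + 7)
    identity = solve-∀

  B+pos-wrap₀ : ∀ i → B + pos 0 (suc k) i ≡ pos 3 0 (2 + i)
  B+pos-wrap₀ i = identity k i
    where
    identity : ∀ k i → 6 * k + 11 + (6 * (1 + k) + 0 + i * (6 * k + 7))
             ≡ 6 * 0 + 3 + (2 + i) * (6 * k + 7)
    identity = solve-∀

  C+pos : ∀ e v i → C + pos e v i ≡ pos e (suc v) (suc i)
  C+pos e v i = identity k e v i
    where
    identity : ∀ k e v i → 6 * k + 13 + (6 * v + e + i * (6 * k + 7))
             ≡ 6 * (1 + v) + e + (1 + i) * (6 * k + 7)
    identity = solve-∀

  C+pos-wrap : ∀ e i → C + pos (suc e) k i ≡ pos e 0 (2 + i)
  C+pos-wrap e i = identity k e i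
    where
    identity : ∀ k e i → 6 * k + 13 + (6 * k + (1 + e) + i * (6 * k + 7))
             ≡ 6 * 0 + e + (2 + i) * (6 * k + 7)
    identity = solve-∀

  C+pos-wrap₀ : ∀ i → C + pos 0 (suc k) i ≡ pos 5 0 (2 + i)
  C+pos-wrap₀ i = identity k i
    where
    identity : ∀ k i → 6 * k + 13 + (6 * (1 + k) + 0 + i * (6 * k + 7))
             ≡ 6 * 0 + 5 + (2 + i) * (6 * k + 7)
    identity = solve-∀

  private
    digit : ∀ e → {True (e <? 6)} → e < 6
    digit e {e<6} = toWitness e<6

  ≤height₂ : ∀ v → v ≤ height 2 v
  ≤height₂ zero    = z≤n
  ≤height₂ (suc v) = n≤1+n (suc v)

  height₂-suc : ∀ v → height 2 (suc v) ≤ suc (height 2 v)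
  height₂-suc zero    = s≤s (s≤s z≤n)
  height₂-suc (suc v) = ≤-refl

  3+≤2+height₂ : ∀ v → 3 + v ≤ 2 + height 2 v
  3+≤2+height₂ zero    = s≤s (s≤s (s≤s z≤n))
  3+≤2+height₂ (suc v) = ≤-refl

  element-A : Element n → Element (A + n)
  element-A (placed e v i e<6 v<w h≤i refl) = placed e v (suc i) e<6 v<w (m≤n⇒m≤1+n h≤i) (A+pos e v i)

  element-B : Element n → Element (B + n)
  element-B (placed 0 v i _ v<w h≤i refl) with m<1+n⇒m<n∨m≡n v<w
  ... | inj₁ v<1+k = placed 4 v (suc i) (digit 4) v<1+k (s≤s h≤i) (B+pos 0 v i)
  ... | inj₂ refl  = placed 3 0 (2 + i) (digit 3) z<s (s≤s (s≤s h≤i)) (B+pos-wrap₀ i)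
  element-B (placed 1 v i _ v<w h≤i refl) =
    placed 5 v (suc i) (digit 5) v<w (m≤n⇒m≤1+n h≤i) (B+pos 1 v i)
  element-B (placed 2 v i _ v<w h≤i refl) =
    placed 0 (suc v) (suc i) (digit 0) (s≤s v<w) (s≤s (≤-trans (≤height₂ v) h≤i)) (B+pos-carry 0 v i)
  element-B (placed 3 v i _ v<w h≤i refl) with m<1+n⇒m<n∨m≡n v<w
  ... | inj₁ v<k = placed 1 (suc v) (suc i) (digit 1) (s≤s v<k) (s≤s h≤i) (B+pos-carry 1 v i)
  ... | inj₂ refl = placed 0 0 (2 + i) (digit 0) z<s z≤n (B+pos-wrap 0 i)
  element-B (placed 4 v i _ v<w h≤i refl) with m<1+n⇒m<n∨m≡n v<w
  ... | inj₁ v<k = placed 2 (suc v) (suc i) (digit 2) (s≤s v<k) (s≤s h≤i) (B+pos-carry 2 v i)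
  ... | inj₂ refl = placed 1 0 (2 + i) (digit 1) z<s (s≤s (s≤s h≤i)) (B+pos-wrap 1 i)
  element-B (placed 5 v i _ v<w h≤i refl) with m<1+n⇒m<n∨m≡n v<w
  ... | inj₁ v<k = placed 3 (suc v) (suc i) (digit 3) (s≤s v<k) (s≤s h≤i) (B+pos-carry 3 v i)
  ... | inj₂ refl = placed 2 0 (2 + i) (digit 2) z<s (s≤s (s≤s h≤i)) (B+pos-wrap 2 i)
  element-B (placed (suc (suc (suc (suc (suc (suc _)))))) _ _ (s≤s (s≤s (s≤s (s≤s (s≤s (s≤s ())))))) _ _ _)

  element-C : Element n → Element (C + n)
  element-C (placed 0 v i _ v<w h≤i refl) with m<1+n⇒m<n∨m≡n v<w
  ... | inj₁ v<1+k = placed 0 (suc v) (suc i) (digit 0) (s≤s v<1+k) (s≤s h≤i) (C+pos 0 v i)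
  ... | inj₂ refl  = placed 5 0 (2 + i) (digit 5) z<s (s≤s (s≤s h≤i)) (C+pos-wrap₀ i)
  element-C (placed 1 v i _ v<w h≤i refl) with m<1+n⇒m<n∨m≡n v<w
  ... | inj₁ v<k = placed 1 (suc v) (suc i) (digit 1) (s≤s v<k) (s≤s h≤i) (C+pos 1 v i)
  ... | inj₂ refl = placed 0 0 (2 + i) (digit 0) z<s z≤n (C+pos-wrap 0 i)
  element-C (placed 2 v i _ v<w h≤i refl) with m<1+n⇒m<n∨m≡n v<w
  ... | inj₁ v<k = placed 2 (suc v) (suc i) (digit 2) (s≤s v<k) (≤-trans (height₂-suc v) (s≤s h≤i)) (C+pos 2 v i)
  ... | inj₂ refl = placed 1 0 (2 + i) (digit 1) z<s (≤-trans (3+≤2+height₂ k) (s≤s (s≤s h≤i))) (C+pos-wrap 1 i)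
  element-C (placed 3 v i _ v<w h≤i refl) with m<1+n⇒m<n∨m≡n v<w
  ... | inj₁ v<k = placed 3 (suc v) (suc i) (digit 3) (s≤s v<k) (s≤s h≤i) (C+pos 3 v i)
  ... | inj₂ refl = placed 2 0 (2 + i) (digit 2) z<s (s≤s (s≤s h≤i)) (C+pos-wrap 2 i)
  element-C (placed 4 v i _ v<w h≤i refl) with m<1+n⇒m<n∨m≡n v<w
  ... | inj₁ v<k = placed 4 (suc v) (suc i) (digit 4) (s≤s v<k) (s≤s h≤i) (C+pos 4 v i)
  ... | inj₂ refl = placed 3 0 (2 + i) (digit 3) z<s (s≤s (s≤s h≤i)) (C+pos-wrap 3 i)
  element-C (placed 5 v i _ v<w h≤i refl) with m<1+n⇒m<n∨m≡n v<w
  ... | inj₁ v<k = placed 5 (suc v) (suc i) (digit 5) (s≤s v<k) (s≤s h≤i) (C+pos 5 v i)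
  ... | inj₂ refl = placed 4 0 (2 + i) (digit 4) z<s (s≤s z≤n) (C+pos-wrap 4 i)
  element-C (placed (suc (suc (suc (suc (suc (suc _)))))) _ _ (s≤s (s≤s (s≤s (s≤s (s≤s (s≤s ())))))) _ _ _)

  ∈S⇒element : S n → Element n
  ∈S⇒element zero∈ = placed 0 0 0 (digit 0) z<s z≤n refl
  ∈S⇒element (add∈ (here refl)                 n∈) = element-A (∈S⇒element n∈)
  ∈S⇒element (add∈ (there (here refl))         n∈) = element-B (∈S⇒element n∈)
  ∈S⇒element (add∈ (there (there (here refl))) n∈) = element-C (∈S⇒element n∈)

  combination∈S : ∀ a b c → S (a * A + b * B + c * C)
  combination∈S a b c = ⟨⟩-+ (⟨⟩-+ (⟨⟩-multiple A∈X a) (⟨⟩-multiple B∈X b)) (⟨⟩-multiple C∈X c)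

  apéry∈S : ∀ e v → e < 6 → S (pos e v (height e v))
  apéry∈S 0 v       _ = subst S (identity k v) (combination∈S 0 0 v)
    where
    identity : ∀ k v → 0 * (6 * k + 7) + 0 * (6 * k + 11) + v * (6 * k + 13)
             ≡ 6 * v + 0 + v * (6 * k + 7)
    identity = solve-∀
  apéry∈S 1 v       _ = subst S (identity k v) (combination∈S 0 2 (v + k))
    where
    identity : ∀ k v → 0 * (6 * k + 7) + 2 * (6 * k + 11) + (v + k) * (6 * k + 13)
             ≡ 6 * v + 1 + (3 + (v + k)) * (6 * k + 7)
    identity = solve-∀
  apéry∈S 2 zero    _ = subst S (identity k) (combination∈S 0 1 (2 + (k + k)))
    where
    identity : ∀ k → 0 * (6 * k + 7) + 1 * (6 * k + 11) + (2 + (k + k)) * (6 * k + 13)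
             ≡ 6 * 0 + 2 + (5 + (k + k)) * (6 * k + 7)
    identity = solve-∀
  apéry∈S 2 (suc v) _ = subst S (identity k v) (combination∈S 0 2 v)
    where
    identity : ∀ k v → 0 * (6 * k + 7) + 2 * (6 * k + 11) + v * (6 * k + 13)
             ≡ 6 * (1 + v) + 2 + (2 + v) * (6 * k + 7)
    identity = solve-∀
  apéry∈S 3 v       _ = subst S (identity k v) (combination∈S 0 1 (1 + (v + k)))
    where
    identity : ∀ k v → 0 * (6 * k + 7) + 1 * (6 * k + 11) + (1 + (v + k)) * (6 * k + 13)
             ≡ 6 * v + 3 + (3 + (v + k)) * (6 * k + 7)
    identity = solve-∀
  apéry∈S 4 v       _ = subst S (identity k v) (combination∈S 0 1 v)
    where
    identity : ∀ k v → 0 * (6 * k + 7) + 1 * (6 * k + 11) + v * (6 * k + 13)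
             ≡ 6 * v + 4 + (1 + v) * (6 * k + 7)
    identity = solve-∀
  apéry∈S 5 v       _ = subst S (identity k v) (combination∈S 0 0 (2 + (v + k)))
    where
    identity : ∀ k v → 0 * (6 * k + 7) + 0 * (6 * k + 11) + (2 + (v + k)) * (6 * k + 13)
             ≡ 6 * v + 5 + (3 + (v + k)) * (6 * k + 7)
    identity = solve-∀
  apéry∈S (suc (suc (suc (suc (suc (suc _)))))) _ (s≤s (s≤s (s≤s (s≤s (s≤s (s≤s ()))))))

  element⇒∈S : Element n → S n
  element⇒∈S (placed e v i e<6 _ h≤i refl) with m≤n⇒∃[o]m+o≡n h≤i
  ... | j , refl = subst S (raise k e v (height e v) j) (⟨⟩-+ (⟨⟩-multiple A∈X j) (apéry∈S e v e<6))
    where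
    raise : ∀ k e v h j → j * (6 * k + 7) + (6 * v + e + h * (6 * k + 7))
                        ≡ 6 * v + e + (h + j) * (6 * k + 7)
    raise = solve-∀

  gap⇔∉S : Gap n ⇔ (¬ S n)
  gap⇔∉S {n} = mk⇔ (λ gap n∈ → gap∩element gap (∈S⇒element n∈))
                   (λ n∉ → [ id , (λ elt → contradiction (element⇒∈S elt) n∉) ]′ (gap-or-element n))

  F : ℕ
  F = 12 * k * k + 38 * k + 30

  F≡pos : F ≡ pos 2 0 (4 + (k + k))
  F≡pos = identity k
    where
    identity : ∀ k → 12 * k * k + 38 * k + 30 ≡ 6 * 0 + 2 + (4 + (k + k)) * (6 * k + 7)
    identity = solve-∀

  F-gap : Gap F
  F-gap = placed 2 0 (4 + (k + k)) (digit 2) z<s (n<1+n _) F≡pos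

  F∉S : ¬ S F
  F∉S = Equivalence.to gap⇔∉S F-gap

  height≤ : ∀ e v → e < 6 → v < width e → e ≡ 2 × v ≡ 0 ⊎ height e v ≤ 3 + (k + k)
  height≤ 0 v       _ (s≤s v≤1+k) = inj₂ (≤-trans v≤1+k (s≤s (m≤n+m k (2 + k))))
  height≤ 1 v       _ (s≤s v≤k)   = inj₂ (+-monoʳ-≤ 3 (+-monoˡ-≤ k v≤k))
  height≤ 2 zero    _ _           = inj₁ (refl , refl)
  height≤ 2 (suc v) _ (s≤s v<k)   = inj₂ (s≤s (s≤s (≤-trans (<⇒≤ v<k) (m≤n+m k (1 + k)))))
  height≤ 3 v       _ (s≤s v≤k)   = inj₂ (+-monoʳ-≤ 3 (+-monoˡ-≤ k v≤k))
  height≤ 4 v       _ (s≤s v≤k)   = inj₂ (s≤s (≤-trans v≤k (m≤n+m k (2 + k))))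
  height≤ 5 v       _ (s≤s v≤k)   = inj₂ (+-monoʳ-≤ 3 (+-monoˡ-≤ k v≤k))
  height≤ (suc (suc (suc (suc (suc (suc _)))))) _ (s≤s (s≤s (s≤s (s≤s (s≤s (s≤s ())))))) _

  gap⇒≤F : Gap n → n ≤ F
  gap⇒≤F (placed e v i e<6 v<w i<h refl) with height≤ e v e<6 v<w
  ... | inj₁ (refl , refl) = begin
    pos 2 0 i                ≤⟨ +-monoʳ-≤ 2 (*-monoˡ-≤ A (≤-pred i<h)) ⟩
    pos 2 0 (4 + (k + k))    ≡⟨ F≡pos ⟨
    F                        ∎
    where open ≤-Reasoning
  ... | inj₂ h≤ = begin
    6 * v + e + i * A              ≤⟨ +-mono-≤ (residue≤ e<6 v<w) (*-monoˡ-≤ A (≤-pred (≤-trans i<h h≤))) ⟩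
    6 * k + 6 + (2 + (k + k)) * A  ≤⟨ bound k ⟩
    F                              ∎
    where
    open ≤-Reasoning
    bound : ∀ k → 6 * k + 6 + (2 + (k + k)) * (6 * k + 7) ≤ 12 * k * k + 38 * k + 30
    bound k = subst (6 * k + 6 + (2 + (k + k)) * (6 * k + 7) ≤_) (slack k) (m≤m+n _ (6 * k + 10))
      where
      slack : ∀ k → 6 * k + 6 + (2 + (k + k)) * (6 * k + 7) + (6 * k + 10) ≡ 12 * k * k + 38 * k + 30
      slack = solve-∀

  F<⇒∈S : F < n → S n
  F<⇒∈S {n} F<n with gap-or-element n
  ... | inj₁ gap = contradiction (gap⇒≤F gap) (<⇒≱ F<n)
  ... | inj₂ elt = element⇒∈S elt

  P : ℕ
  P = 12 * k * k + 32 * k + 15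

  P≡pos : P ≡ pos 1 k (2 + (k + k))
  P≡pos = identity k
    where
    identity : ∀ k → 12 * k * k + 32 * k + 15 ≡ 6 * k + 1 + (2 + (k + k)) * (6 * k + 7)
    identity = solve-∀

  P-gap : Gap P
  P-gap = placed 1 k (2 + (k + k)) (digit 1) (n<1+n k) (n<1+n _) P≡pos

  last-gap : ∀ e v i → e < 6 → v < width e → height e v ≡ suc i →
             ¬ Gap (B + pos e v i) → ¬ Gap (C + pos e v i) → pos e v i ≡ P ⊎ pos e v i ≡ F
  last-gap 0 v i _ v<w refl B+∉ _ with m<1+n⇒m<n∨m≡n v<w
  ... | inj₁ v<1+k = contradiction (placed 4 v (suc i) (digit 4) v<1+k ≤-refl (B+pos 0 v i)) B+∉
  ... | inj₂ refl  = contradiction (placed 3 0 (2 + k) (digit 3) z<s ≤-refl (B+pos-wrap₀ k)) B+∉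
  last-gap 1 v i _ v<w refl _ C+∉ with m<1+n⇒m<n∨m≡n v<w
  ... | inj₁ v<k  = contradiction (placed 1 (suc v) (suc i) (digit 1) (s≤s v<k) ≤-refl (C+pos 1 v i)) C+∉
  ... | inj₂ refl = inj₁ (sym P≡pos)
  last-gap 2 zero i _ _ refl _ _ = inj₂ (sym F≡pos)
  last-gap 2 (suc v) i _ v<w refl _ C+∉ with m<1+n⇒m<n∨m≡n v<w
  ... | inj₁ v<k = contradiction (placed 2 (2 + v) (2 + v) (digit 2) (s≤s v<k) ≤-refl (C+pos 2 (suc v) i)) C+∉
  ... | inj₂ v≡k = contradiction
    (placed 1 0 (2 + i) (digit 1) z<s (+-monoʳ-< 3 (≤-reflexive v≡k))
            (trans (cong (λ w → C + pos 2 w i) v≡k) (C+pos-wrap 1 i)))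
    C+∉
  last-gap 3 v i _ v<w refl _ C+∉ with m<1+n⇒m<n∨m≡n v<w
  ... | inj₁ v<k  = contradiction (placed 3 (suc v) (suc i) (digit 3) (s≤s v<k) ≤-refl (C+pos 3 v i)) C+∉
  ... | inj₂ refl = contradiction (placed 2 0 (2 + i) (digit 2) z<s ≤-refl (C+pos-wrap 2 i)) C+∉
  last-gap 4 v i _ v<w refl B+∉ _ with m<1+n⇒m<n∨m≡n v<w
  ... | inj₁ v<k  = contradiction (placed 2 (suc v) (suc i) (digit 2) (s≤s v<k) ≤-refl (B+pos-carry 2 v i)) B+∉
  ... | inj₂ refl = contradiction (placed 1 0 (2 + i) (digit 1) z<s ≤-refl (B+pos-wrap 1 i)) B+∉
  last-gap 5 v i _ v<w refl B+∉ _ with m<1+n⇒m<n∨m≡n v<w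
  ... | inj₁ v<k  = contradiction (placed 3 (suc v) (suc i) (digit 3) (s≤s v<k) ≤-refl (B+pos-carry 3 v i)) B+∉
  ... | inj₂ refl = contradiction (placed 2 0 (2 + i) (digit 2) z<s ≤-refl (B+pos-wrap 2 i)) B+∉
  last-gap (suc (suc (suc (suc (suc (suc _)))))) _ _ (s≤s (s≤s (s≤s (s≤s (s≤s (s≤s ())))))) _ _ _ _

  isPF⇒¬gap : IsPF S (+ n) → S g → g ≢ 0 → ¬ Gap (g + n)
  isPF⇒¬gap {n} {g} pf g∈ g≢0 gap = Equivalence.to gap⇔∉S gap (subst S (+-comm n g) (isPF⁻ pf g∈ g≢0))

  isPF⇒P⊎F : IsPF S (+ n) → n ≡ P ⊎ n ≡ F
  isPF⇒P⊎F {n} pf with Equivalence.from gap⇔∉S (λ n∈ → proj₁ pf (n , refl , n∈))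
  ... | placed e v i e<6 v<w i<h refl with m≤n⇒m<n∨m≡n i<h
  ...   | inj₁ 1+i<h = contradiction (placed e v (suc i) e<6 v<w 1+i<h (A+pos e v i))
                                     (isPF⇒¬gap pf (⟨⟩-generator A∈X) A≢0)
  ...   | inj₂ 1+i≡h = last-gap e v i e<6 v<w (sym 1+i≡h)
                         (isPF⇒¬gap pf (⟨⟩-generator B∈X) B≢0) (isPF⇒¬gap pf (⟨⟩-generator C∈X) C≢0)

  isPF-P : IsPF S (+ P)
  isPF-P = isPF⁺ (Equivalence.to gap⇔∉S P-gap) P+
    where
    P+ : ∀ {g} → g ∈ X → S (P + g)
    P+ (here refl)                 = subst S (P+A k) (combination∈S 0 2 (k + k))
      where
      P+A : ∀ k → 0 * (6 * k + 7) + 2 * (6 * k + 11) + (k + k) * (6 * k + 13)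
             ≡ 12 * k * k + 32 * k + 15 + (6 * k + 7)
      P+A = solve-∀
    P+ (there (here refl))         = subst S (P+B k) (combination∈S 0 0 (2 + (k + k)))
      where
      P+B : ∀ k → 0 * (6 * k + 7) + 0 * (6 * k + 11) + (2 + (k + k)) * (6 * k + 13)
             ≡ 12 * k * k + 32 * k + 15 + (6 * k + 11)
      P+B = solve-∀
    P+ (there (there (here refl))) = subst S (P+C k) (combination∈S (4 + (k + k)) 0 0)
      where
      P+C : ∀ k → (4 + (k + k)) * (6 * k + 7) + 0 * (6 * k + 11) + 0 * (6 * k + 13)
             ≡ 12 * k * k + 32 * k + 15 + (6 * k + 13)
      P+C = solve-∀

  isPF-F : IsPF S (+ F)
  isPF-F = isPF⁺ F∉S F+
    where
    F+ : ∀ {g} → g ∈ X → S (F + g)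
    F+ (here refl)                 = subst S (F+A k) (combination∈S 0 1 (2 + (k + k)))
      where
      F+A : ∀ k → 0 * (6 * k + 7) + 1 * (6 * k + 11) + (2 + (k + k)) * (6 * k + 13)
             ≡ 12 * k * k + 38 * k + 30 + (6 * k + 7)
      F+A = solve-∀
    F+ (there (here refl))         = subst S (F+B k) (combination∈S (4 + (k + k)) 0 1)
      where
      F+B : ∀ k → (4 + (k + k)) * (6 * k + 7) + 0 * (6 * k + 11) + 1 * (6 * k + 13)
             ≡ 12 * k * k + 38 * k + 30 + (6 * k + 11)
      F+B = solve-∀
    F+ (there (there (here refl))) = subst S (F+C k) (combination∈S (3 + (k + k)) 2 0)
      where
      F+C : ∀ k → (3 + (k + k)) * (6 * k + 7) + 2 * (6 * k + 11) + 0 * (6 * k + 13)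
             ≡ 12 * k * k + 38 * k + 30 + (6 * k + 13)
      F+C = solve-∀

  isPF⇔ : ∀ x → IsPF S x ⇔ (x ≡ + P ⊎ x ≡ + F)
  isPF⇔ _ = mk⇔ to from
    where
    to : ∀ {x} → IsPF S x → x ≡ + P ⊎ x ≡ + F
    to { -[1+ _ ]} pf = contradiction pf (isPF⇒nonNegative F∉S F<⇒∈S)
    to {+ _}       pf = Sum.map (cong (λ n → + n)) (cong (λ n → + n)) (isPF⇒P⊎F pf)
    from : ∀ {x} → x ≡ + P ⊎ x ≡ + F → IsPF S x
    from (inj₁ refl) = isPF-P
    from (inj₂ refl) = isPF-F

  IsGapPosition : ℕ × ℕ × ℕ → Set
  IsGapPosition (e , v , i) = e < 6 × v < width e × i < height e v

  column : ℕ → List (ℕ × ℕ)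
  column e = dependentProduct (downFrom (width e)) λ v → downFrom (height e v)

  gapPositions : List (ℕ × ℕ × ℕ)
  gapPositions = dependentProduct (downFrom 6) column

  ∈gapPositions⁺ : ∀ {t} → IsGapPosition t → t ∈ gapPositions
  ∈gapPositions⁺ {e , _ , _} (e<6 , v<w , i<h) =
    ∈-dependentProduct⁺ column (∈-downFrom⁺ e<6)
      (∈-dependentProduct⁺ (λ v → downFrom (height e v)) (∈-downFrom⁺ v<w) (∈-downFrom⁺ i<h))

  ∈gapPositions⁻ : ∀ {t} → t ∈ gapPositions → IsGapPosition t
  ∈gapPositions⁻ {e , _ , _} t∈ with ∈-dependentProduct⁻ (downFrom 6) column t∈
  ... | e∈ , vi∈ with ∈-dependentProduct⁻ (downFrom (width e)) (λ v → downFrom (height e v)) vi∈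
  ...   | v∈ , i∈ = ∈-downFrom⁻ e∈ , ∈-downFrom⁻ v∈ , ∈-downFrom⁻ i∈

  pos³ : ℕ × ℕ × ℕ → ℕ
  pos³ (e , v , i) = pos e v i

  gaps : List ℕ
  gaps = map pos³ gapPositions

  gaps-unique : Unique gaps
  gaps-unique = map-injectiveOn⁺ pos³ pos-injectiveOn (All.tabulate ∈gapPositions⁻)
    (dependentProduct⁺ (downFrom⁺ 6) λ e →
       dependentProduct⁺ (downFrom⁺ (width e)) λ v → downFrom⁺ (height e v))
    where
    pos-injectiveOn : ∀ {t t′} → IsGapPosition t → IsGapPosition t′ → pos³ t ≡ pos³ t′ → t ≡ t′
    pos-injectiveOn {_ , _ , i} {_ , _ , i′} (e<6 , v<w , _) (e′<6 , v′<w′ , _) eq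
      with pos-injective {i = i} {i′ = i′} e<6 v<w e′<6 v′<w′ eq
    ... | refl , refl , refl = refl

  ∈gaps⇔∉S : ∀ n → n ∈ gaps ⇔ (¬ S n)
  ∈gaps⇔∉S n = mk⇔ to from
    where
    to : n ∈ gaps → ¬ S n
    to n∈ with ∈-map⁻ pos³ n∈
    ... | (e , v , i) , t∈ , n≡ with ∈gapPositions⁻ {e , v , i} t∈
    ...   | e<6 , v<w , i<h = Equivalence.to gap⇔∉S (placed e v i e<6 v<w i<h n≡)
    from : ¬ S n → n ∈ gaps
    from n∉ with Equivalence.from gap⇔∉S n∉
    ... | placed e v i e<6 v<w i<h n≡ =
      subst (_∈ gaps) (sym n≡) (∈-map⁺ pos³ (∈gapPositions⁺ {e , v , i} (e<6 , v<w , i<h)))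

  columnSum : ℕ → ℕ
  columnSum e = sum (map (height e) (downFrom (width e)))

  length-gaps : length gaps ≡ sum (map columnSum (downFrom 6))
  length-gaps = begin
    length gaps                                      ≡⟨ length-map pos³ gapPositions ⟩
    length gapPositions                              ≡⟨ length-dependentProduct (downFrom 6) column ⟩
    sum (map (λ e → length (column e)) (downFrom 6)) ≡⟨ cong sum (map-cong length-column (downFrom 6)) ⟩
    sum (map columnSum (downFrom 6))                 ∎
    where
    open ≡-Reasoning
    length-column : ∀ e → length (column e) ≡ columnSum e
    length-column e = trans (length-dependentProduct (downFrom (width e)) (λ v → downFrom (height e v)))
                            (cong sum (map-cong (λ v → length-downFrom (height e v)) (downFrom (width e))))

  -- Columns 1, 3 and 5 have the same heights, and column 2 is affine only after its first entry.
  sum-columnSum : sum (map columnSum (downFrom 6)) ≡ 6 * k * k + 20 * k + 16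
  sum-columnSum =
    trans (cong (λ c → columnSum 5 + (columnSum 4 + (columnSum 3 + (c + (columnSum 1 + (columnSum 0 + 0))))))
                (sum-downFrom-suc (height 2) k))
          (genus-arithmetic k (columnSum 0) (columnSum 1) _ (columnSum 4)
             (sum-downFrom-affine 0 (2 + k) λ _ → refl)
             (sum-downFrom-affine (3 + k) (1 + k) λ v → cong (λ x → 3 + x) (+-comm v k))
             (sum-downFrom-affine 2 k λ _ → refl)
             (sum-downFrom-affine 1 (1 + k) λ _ → refl))

  genus : HasGenus S (6 * k * k + 20 * k + 16)
  genus = gaps , gaps-unique , ∈gaps⇔∉S , trans length-gaps sum-columnSum

corollary16 : (k : ℕ) →
    ((x : ℤ) → IsPF ⟨ (6 * k + 7) ∷ (6 * k + 11) ∷ (6 * k + 13) ∷ [] ⟩ x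
        ⇔ (x ≡ + (12 * k * k + 32 * k + 15) ⊎ x ≡ + (12 * k * k + 38 * k + 30)))
    × IsFrobenius ⟨ (6 * k + 7) ∷ (6 * k + 11) ∷ (6 * k + 13) ∷ [] ⟩ (+ (12 * k * k + 38 * k + 30))
    × HasGenus ⟨ (6 * k + 7) ∷ (6 * k + 11) ∷ (6 * k + 13) ∷ [] ⟩ (6 * k * k + 20 * k + 16)
corollary16 k = isPF⇔ , isFrobenius F∉S F<⇒∈S , genus
  where open Semigroup k
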